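{- For $n\ge3$, $$P_n(s,t)=\sum_{k=0}^{\phi(n)/2}c_k\,s^{\phi(n)-2k}t^k$$ for certain constants $c_k$, where $c_0=1$ and $$c_{\phi(n)/2}=\begin{cases}p & \text{if } n=2\cdot p^m \text{ for a prime } p\ge2 \text{ and } m\ge1,\\ 1 & \text{otherwise.}\end{cases}$$
   Context: Let $\Phi_n(q)$ be the $n$th cyclotomic polynomial and $\phi$ the Euler totient function. For $n\ge 2$, $\Phi_n(q)$ is palindromic of degree $\phi(n)$ with constant term $1$, so there are unique complex numbers $\gamma_j$ with $\Phi_n(q)=\sum_{0\le j\le \phi(n)/2}\gamma_j q^j(1+q)^{\phi(n)-2j}$; the $n$th Lucas atom is $P_n(s,t)=\sum_j \gamma_j s^{\phi(n)-2j}(-t)^j$. -}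

module Defs where

open import Data.Nat as ℕ using (ℕ; zero; suc)
open import Data.Nat.Divisibility using (_∣?_)
open import Data.Nat.Coprimality using (coprime?)
open import Data.Integer as ℤ using (ℤ; +_; -_; _+_; _*_)
open import Data.List using (List; []; _∷_; filter; length; foldr; map)
open import Data.List.Base using (upTo)
open import Relation.Binary.PropositionalEquality using (_≡_)

range1 : ℕ → List ℕ
range1 n = map suc (upTo n)

totient : ℕ → ℕ
totient n = length (filter (λ k → coprime? k n) (range1 n))

-- Polynomials in one variable with integer coefficients,
-- represented by little-endian coefficient lists.
Poly : Set
Poly = List ℤ

coeff : Poly → ℕ → ℤ
coeff []       _       = + 0
coeff (a ∷ _)  zero    = a
coeff (_ ∷ p)  (suc i) = coeff p i

infix 4 _≈ₚ_
_≈ₚ_ : Poly → Poly → Set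
p ≈ₚ q = ∀ i → coeff p i ≡ coeff q i

infixl 6 _+ₚ_
_+ₚ_ : Poly → Poly → Poly
[]      +ₚ q       = q
p       +ₚ []      = p
(a ∷ p) +ₚ (b ∷ q) = (a + b) ∷ (p +ₚ q)

scale : ℤ → Poly → Poly
scale c = map (c *_)

infixl 7 _*ₚ_
_*ₚ_ : Poly → Poly → Poly
[]      *ₚ q = []
(a ∷ p) *ₚ q = scale a q +ₚ (+ 0 ∷ (p *ₚ q))

oneₚ : Poly
oneₚ = + 1 ∷ []

X : Poly
X = + 0 ∷ + 1 ∷ []

infixr 8 _^ₚ_
_^ₚ_ : Poly → ℕ → Poly
p ^ₚ zero  = oneₚ
p ^ₚ suc k = p *ₚ (p ^ₚ k)

prodₚ : List Poly → Poly
prodₚ = foldr _*ₚ_ oneₚ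

sumₚ : List Poly → Poly
sumₚ = foldr _+ₚ_ []

Xpow-1 : ℕ → Poly
Xpow-1 m = (X ^ₚ m) +ₚ (- + 1 ∷ [])

divisors : ℕ → List ℕ
divisors m = filter (λ d → d ∣? m) (range1 m)

-- A family of polynomials Φ is the family of cyclotomic polynomials
-- iff  q^m - 1 = ∏_{d ∣ m} Φ_d(q)  for every m ≥ 1.
-- (This determines Φ_m uniquely for every m ≥ 1, by strong induction,
--  since ℤ[q] is an integral domain.)
IsCyclotomicFamily : (ℕ → Poly) → Set
IsCyclotomicFamily Φ = ∀ m → 1 ℕ.≤ m → prodₚ (map Φ (divisors m)) ≈ₚ Xpow-1 m

range0 : ℕ → List ℕ
range0 k = upTo (suc k)

lucasExpansion : ℕ → (ℕ → ℤ) → Poly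
lucasExpansion n γ =
  sumₚ (map (λ j → scale (γ j) ((X ^ₚ j) *ₚ ((oneₚ +ₚ X) ^ₚ (totient n ℕ.∸ 2 ℕ.* j))))
            (range0 (totient n ℕ./ 2)))

-- Coefficient of s^(φ(n)-2k) t^k in the Lucas atom
-- P_n(s,t) = Σ_j γ_j s^(φ(n)-2j) (-t)^j, i.e. (-1)^k γ_k.
signPow : ℕ → ℤ
signPow zero    = + 1
signPow (suc k) = - signPow k

lucasCoeff : (ℕ → ℤ) → ℕ → ℤ
lucasCoeff γ k = signPow k * γ k

-- Evaluate Φₙ(q) = Σⱼ γⱼ qʲ (1 + q)^(φ - 2j) at two points. At q = 0 only γ₀ survives; at q = -1
-- only j = φ/2 survives, giving (-1)^(φ/2) γ_(φ/2), and Φₙ(-1) > 0 rules out the vanishing case.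
-- The values Φₙ(0) and Φₙ(-1) come from q^m - 1 = ∏_{d ∣ m} Φ_d(q) by induction over divisors:
-- when c^m = c the factor Φ₁(c) = c - 1 is the whole product, so Φ_m(0) = 1 (m ≥ 2) and
-- Φ_m(-1) = 1 (m ≥ 3 odd). For n = 2e the factor Φ₂(-1) vanishes, so the identity is
-- differentiated at q = -1 (evaluation at -1 + ε with ε² = 0): ∏_{2 ≤ d ∣ e} Φ_{2d}(-1) = e,
-- which forces Φ_{2e}(-1) = p when e is a power of the prime p and Φ_{2e}(-1) = 1 otherwise.
module Submission where

open import Defs
open import Data.Nat using (ℕ)

module Products where
  open import Data.Nat as ℕ using (ℕ; zero; suc; _≤_; _<_; _∸_; z≤n; s≤s)
  import Data.Nat.Properties as ℕₚ
  open import Data.Nat.Divisibility using (_∣_; _∣?_; 1∣_; ∣-refl; ∣-trans; ∣⇒≤; >⇒∤; *-cancelˡ-∣; *-monoʳ-∣)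
  open import Data.Integer using (ℤ; +_; _*_)
  import Data.Integer.Properties as ℤₚ
  open import Data.Integer.Tactic.RingSolver using (solve-∀)
  open import Data.List using (List; []; _∷_; foldr; map; filter; applyUpTo)
  import Data.List.Properties as Listₚ
  open import Data.Empty using (⊥-elim)
  open import Data.Product using (∃-syntax; _,_)
  open import Relation.Nullary using (yes; no; ¬_)
  open import Relation.Binary.PropositionalEquality
  open ≡-Reasoning

  product : List ℤ → ℤ
  product = foldr _*_ (+ 1)

  ∏< : ℕ → (ℕ → ℤ) → ℤ
  ∏< k f = product (applyUpTo f k)

  syntax ∏< k (λ i → e) = ∏[ i < k ] e

  ∏<-cong : ∀ k {f g} → (∀ i → i < k → f i ≡ g i) → ∏< k f ≡ ∏< k g
  ∏<-cong zero    f≡g = refl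
  ∏<-cong (suc k) f≡g =
    cong₂ _*_ (f≡g 0 (s≤s z≤n)) (∏<-cong k (λ i i<k → f≡g (suc i) (s≤s i<k)))

  ∏<-one : ∀ k {f} → (∀ i → i < k → f i ≡ + 1) → ∏< k f ≡ + 1
  ∏<-one zero    f≡1 = refl
  ∏<-one (suc k) f≡1 =
    cong₂ _*_ (f≡1 0 (s≤s z≤n)) (∏<-one k (λ i i<k → f≡1 (suc i) (s≤s i<k)))

  ∏<-suc : ∀ k f → ∏< (suc k) f ≡ ∏< k f * f k
  ∏<-suc zero    f = ℤₚ.*-comm (f 0) (+ 1)
  ∏<-suc (suc k) f = begin
    f 0 * ∏< (suc k) (λ i → f (suc i))           ≡⟨ cong (f 0 *_) (∏<-suc k (λ i → f (suc i))) ⟩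
    f 0 * (∏< k (λ i → f (suc i)) * f (suc k))   ≡⟨ ℤₚ.*-assoc (f 0) _ _ ⟨
    f 0 * ∏< k (λ i → f (suc i)) * f (suc k)     ∎

  ∏<-* : ∀ k f g → ∏[ i < k ] (f i * g i) ≡ ∏< k f * ∏< k g
  ∏<-* zero    f g = refl
  ∏<-* (suc k) f g = begin
    f 0 * g 0 * ∏[ i < k ] (f (suc i) * g (suc i))                   ≡⟨ cong (f 0 * g 0 *_) (∏<-* k _ _) ⟩
    f 0 * g 0 * (∏< k (λ i → f (suc i)) * ∏< k (λ i → g (suc i)))   ≡⟨ interchange (f 0) (g 0) _ _ ⟩
    f 0 * ∏< k (λ i → f (suc i)) * (g 0 * ∏< k (λ i → g (suc i)))   ∎
    where
    interchange : ∀ a b c d → a * b * (c * d) ≡ a * c * (b * d)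
    interchange = solve-∀

  ∏<-extend : ∀ {j k} f → j ≤ k → (∀ i → j ≤ i → i < k → f i ≡ + 1) → ∏< k f ≡ ∏< j f
  ∏<-extend {zero}            f z≤n       f≡1 = ∏<-one _ (λ i → f≡1 i z≤n)
  ∏<-extend {suc j} {suc k} f (s≤s j≤k) f≡1 =
    cong (f 0 *_) (∏<-extend (λ i → f (suc i)) j≤k (λ i j≤i i<k → f≡1 (suc i) (s≤s j≤i) (s≤s i<k)))

  ∏<-pairs : ∀ k f → ∏< (2 ℕ.* k) f ≡ ∏[ i < k ] (f (2 ℕ.* i) * f (suc (2 ℕ.* i)))
  ∏<-pairs zero    f = refl
  ∏<-pairs (suc k) f = begin
    ∏< (2 ℕ.* suc k) f                               ≡⟨ cong (λ m → ∏< m f) (ℕₚ.*-suc 2 k) ⟩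
    ∏< (suc (suc (2 ℕ.* k))) f                       ≡⟨ ∏<-suc (suc (2 ℕ.* k)) f ⟩
    ∏< (suc (2 ℕ.* k)) f * f (suc (2 ℕ.* k))         ≡⟨ cong (_* f (suc (2 ℕ.* k))) (∏<-suc (2 ℕ.* k) f) ⟩
    ∏< (2 ℕ.* k) f * f (2 ℕ.* k) * f (suc (2 ℕ.* k)) ≡⟨ ℤₚ.*-assoc (∏< (2 ℕ.* k) f) _ _ ⟩
    ∏< (2 ℕ.* k) f * (f (2 ℕ.* k) * f (suc (2 ℕ.* k))) ≡⟨ cong (_* pair k) (∏<-pairs k f) ⟩
    ∏< k pair * pair k                               ≡⟨ ∏<-suc k pair ⟨
    ∏< (suc k) pair                                  ∎
    where
    pair : ℕ → ℤ
    pair i = f (2 ℕ.* i) * f (suc (2 ℕ.* i))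

  ∏<-positive : ∀ k f → (∀ i → i < k → ∃[ t ] f i ≡ + suc t) → ∃[ t ] ∏< k f ≡ + suc t
  ∏<-positive zero    f _   = 0 , refl
  ∏<-positive (suc k) f pos with pos 0 (s≤s z≤n) | ∏<-positive k (λ i → f (suc i)) (λ i i<k → pos (suc i) (s≤s i<k))
  ... | a , f0≡ | b , rest≡ = b ℕ.+ a ℕ.* suc b , cong₂ _*_ f0≡ rest≡

  whenDivides : ℕ → (ℕ → ℤ) → ℕ → ℤ
  whenDivides m f d with d ∣? m
  ... | yes _ = f d
  ... | no  _ = + 1

  unlessDivides : ℕ → (ℕ → ℤ) → ℕ → ℤ
  unlessDivides m f d with d ∣? m
  ... | yes _ = + 1
  ... | no  _ = f d

  product-map-filter : ∀ m f xs → product (map f (filter (_∣? m) xs)) ≡ product (map (whenDivides m f) xs)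
  product-map-filter m f []       = refl
  product-map-filter m f (x ∷ xs) with x ∣? m
  ... | yes _ = cong (f x *_) (product-map-filter m f xs)
  ... | no  _ = trans (product-map-filter m f xs) (sym (ℤₚ.*-identityˡ _))

  divisors-suc : ∀ k → divisors (suc k) ≡ 1 ∷ filter (_∣? suc k) (applyUpTo (2 ℕ.+_) k)
  divisors-suc k = trans (cong (filter (_∣? suc k)) (Listₚ.map-upTo suc (suc k)))
                         (Listₚ.filter-accept (_∣? suc k) (1∣ suc k))

  divisors≥3 : ℕ → List ℕ
  divisors≥3 m = filter (_∣? m) (applyUpTo (3 ℕ.+_) (m ∸ 2))

  divisors-2+ : ∀ j → 2 ∣ 2 ℕ.+ j → divisors (2 ℕ.+ j) ≡ 1 ∷ 2 ∷ divisors≥3 (2 ℕ.+ j)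
  divisors-2+ j 2∣ = trans (divisors-suc (suc j)) (cong (1 ∷_) (Listₚ.filter-accept (_∣? 2 ℕ.+ j) 2∣))

  whenDivides-self : ∀ m f → whenDivides m f m ≡ f m
  whenDivides-self m f with m ∣? m
  ... | yes _     = refl
  ... | no  m∤m   = ⊥-elim (m∤m ∣-refl)

  whenDivides-twice : ∀ m g d → whenDivides (2 ℕ.* m) g (2 ℕ.* d) ≡ whenDivides m (λ x → g (2 ℕ.* x)) d
  whenDivides-twice m g d with 2 ℕ.* d ∣? 2 ℕ.* m | d ∣? m
  ... | yes _       | yes _   = refl
  ... | yes 2d∣2m   | no  d∤m = ⊥-elim (d∤m (*-cancelˡ-∣ 2 2d∣2m))
  ... | no  2d∤2m   | yes d∣m = ⊥-elim (2d∤2m (*-monoʳ-∣ 2 d∣m))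
  ... | no  _       | no  _   = refl

  whenDivides-preserves : ∀ (P : ℤ → Set) m f d → P (+ 1) → (d ∣ m → P (f d)) → P (whenDivides m f d)
  whenDivides-preserves P m f d P1 Pf with d ∣? m
  ... | yes d∣m = Pf d∣m
  ... | no  _   = P1

  unlessDivides-∣ : ∀ {c d} f → d ∣ c → unlessDivides c f d ≡ + 1
  unlessDivides-∣ {c} {d} f d∣c with d ∣? c
  ... | yes _   = refl
  ... | no  d∤c = ⊥-elim (d∤c d∣c)

  unlessDivides-∤ : ∀ {c d} f → ¬ d ∣ c → unlessDivides c f d ≡ f d
  unlessDivides-∤ {c} {d} f d∤c with d ∣? c
  ... | yes d∣c = ⊥-elim (d∤c d∣c)
  ... | no  _   = refl

  whenDivides-beyond : ∀ c f {d} → suc c < d → whenDivides (suc c) f d ≡ + 1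
  whenDivides-beyond c f {d} c<d with d ∣? suc c
  ... | yes d∣c = ⊥-elim (>⇒∤ c<d d∣c)
  ... | no  _   = refl

  whenDivides-split : ∀ {c e} f d → c ∣ e →
    whenDivides e f d ≡ whenDivides c f d * whenDivides e (unlessDivides c f) d
  whenDivides-split {c} {e} f d c∣e with d ∣? e
  ... | yes _ with d ∣? c
  ...   | yes _   = sym (ℤₚ.*-identityʳ (f d))
  ...   | no  _   = sym (ℤₚ.*-identityˡ (f d))
  whenDivides-split {c} {e} f d c∣e | no d∤e with d ∣? c
  ...   | yes d∣c = ⊥-elim (d∤e (∣-trans d∣c c∣e))
  ...   | no  _   = refl

  ∏⁺∣ : ℕ → (ℕ → ℤ) → ℤ
  ∏⁺∣ m f = ∏[ i < m ∸ 1 ] whenDivides m f (2 ℕ.+ i)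

  product-divisors : ∀ k f → product (map f (divisors (suc k))) ≡ f 1 * ∏⁺∣ (suc k) f
  product-divisors k f = begin
    product (map f (divisors (suc k)))
      ≡⟨ cong (λ ds → product (map f ds)) (divisors-suc k) ⟩
    f 1 * product (map f (filter (_∣? suc k) (applyUpTo (2 ℕ.+_) k)))
      ≡⟨ cong (f 1 *_) (product-map-filter (suc k) f (applyUpTo (2 ℕ.+_) k)) ⟩
    f 1 * product (map (whenDivides (suc k) f) (applyUpTo (2 ℕ.+_) k))
      ≡⟨ cong (λ xs → f 1 * product xs) (Listₚ.map-applyUpTo (2 ℕ.+_) (whenDivides (suc k) f) k) ⟩
    f 1 * ∏⁺∣ (suc k) f
      ∎

  ∏⁺∣-last : ∀ k f → ∏⁺∣ (2 ℕ.+ k) f ≡ ∏[ i < k ] whenDivides (2 ℕ.+ k) f (2 ℕ.+ i) * f (2 ℕ.+ k)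
  ∏⁺∣-last k f = trans (∏<-suc k (λ i → whenDivides (2 ℕ.+ k) f (2 ℕ.+ i)))
    (cong (∏[ i < k ] whenDivides (2 ℕ.+ k) f (2 ℕ.+ i) *_) (whenDivides-self (2 ℕ.+ k) f))

  ∏⁺∣-split : ∀ {c e} f → 1 ≤ c → c ∣ e → 1 ≤ e →
    ∏⁺∣ e f ≡ ∏⁺∣ c f * ∏⁺∣ e (unlessDivides c f)
  ∏⁺∣-split {suc c} {suc e} f _ c∣e _ = begin
    ∏⁺∣ (suc e) f
      ≡⟨ ∏<-cong e (λ i _ → whenDivides-split f (2 ℕ.+ i) c∣e) ⟩
    ∏[ i < e ] (whenDivides (suc c) f (2 ℕ.+ i) * whenDivides (suc e) (unlessDivides (suc c) f) (2 ℕ.+ i))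
      ≡⟨ ∏<-* e _ _ ⟩
    ∏[ i < e ] whenDivides (suc c) f (2 ℕ.+ i) * ∏⁺∣ (suc e) (unlessDivides (suc c) f)
      ≡⟨ cong (_* ∏⁺∣ (suc e) (unlessDivides (suc c) f))
              (∏<-extend _ c≤e (λ i c≤i _ → whenDivides-beyond c f (s≤s (s≤s c≤i)))) ⟩
    ∏⁺∣ (suc c) f * ∏⁺∣ (suc e) (unlessDivides (suc c) f)
      ∎
    where
    c≤e : c ≤ e
    c≤e = ℕₚ.≤-pred (∣⇒≤ c∣e)

  product-divisors≥3-even : ∀ k g → (∀ i → g (3 ℕ.+ 2 ℕ.* i) ≡ + 1) →
    product (map g (divisors≥3 (2 ℕ.+ 2 ℕ.* k))) ≡ ∏⁺∣ (suc k) (λ d → g (2 ℕ.* d))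
  product-divisors≥3-even k g odd≡1 = begin
    product (map g (divisors≥3 m))
      ≡⟨ product-map-filter m g (applyUpTo (3 ℕ.+_) (2 ℕ.* k)) ⟩
    product (map (whenDivides m g) (applyUpTo (3 ℕ.+_) (2 ℕ.* k)))
      ≡⟨ cong product (Listₚ.map-applyUpTo (3 ℕ.+_) (whenDivides m g) (2 ℕ.* k)) ⟩
    ∏[ j < 2 ℕ.* k ] whenDivides m g (3 ℕ.+ j)
      ≡⟨ ∏<-pairs k (λ j → whenDivides m g (3 ℕ.+ j)) ⟩
    ∏[ i < k ] (whenDivides m g (3 ℕ.+ 2 ℕ.* i) * whenDivides m g (4 ℕ.+ 2 ℕ.* i))
      ≡⟨ ∏<-cong k (λ i _ → cong₂ _*_ (odd-factor i) (even-factor i)) ⟩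
    ∏[ i < k ] (+ 1 * whenDivides (suc k) (λ d → g (2 ℕ.* d)) (2 ℕ.+ i))
      ≡⟨ ∏<-cong k (λ i _ → ℤₚ.*-identityˡ _) ⟩
    ∏⁺∣ (suc k) (λ d → g (2 ℕ.* d))
      ∎
    where
    m = 2 ℕ.+ 2 ℕ.* k
    odd-factor : ∀ i → whenDivides m g (3 ℕ.+ 2 ℕ.* i) ≡ + 1
    odd-factor i = whenDivides-preserves (_≡ + 1) m g (3 ℕ.+ 2 ℕ.* i) refl (λ _ → odd≡1 i)
    2*[2+i]≡4+2*i : ∀ i → 2 ℕ.* (2 ℕ.+ i) ≡ 4 ℕ.+ 2 ℕ.* i
    2*[2+i]≡4+2*i i = trans (ℕₚ.*-suc 2 (suc i)) (cong (2 ℕ.+_) (ℕₚ.*-suc 2 i))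
    even-factor : ∀ i → whenDivides m g (4 ℕ.+ 2 ℕ.* i) ≡ whenDivides (suc k) (λ d → g (2 ℕ.* d)) (2 ℕ.+ i)
    even-factor i = trans (cong₂ (λ a b → whenDivides a g b) (sym (ℕₚ.*-suc 2 k)) (sym (2*[2+i]≡4+2*i i)))
                          (whenDivides-twice (suc k) g (2 ℕ.+ i))

module DualNumbers where
  open import Data.Nat using (ℕ; zero; suc)
  open import Data.Integer using (ℤ; +_; _+_; _*_; _^_)
  import Data.Integer.Properties as ℤₚ
  open import Data.Integer.Tactic.RingSolver using (solve-∀)
  open import Data.Product using (_×_; _,_; proj₁)
  open import Data.List using (List; []; _∷_; foldr; map)
  open import Relation.Binary.PropositionalEquality
  open ≡-Reasoning
  open Products using (product)

  Dual : Set
  Dual = ℤ × ℤ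

  infixl 6 _+ᴰ_
  infixl 7 _*ᴰ_
  infixr 8 _^ᴰ_

  _+ᴰ_ _*ᴰ_ : Dual → Dual → Dual
  (a , a′) +ᴰ (b , b′) = (a + b , a′ + b′)
  (a , a′) *ᴰ (b , b′) = (a * b , a * b′ + a′ * b)

  ↑ : ℤ → Dual
  ↑ a = (a , + 0)

  _+ε : ℤ → Dual
  c +ε = (c , + 1)

  _^ᴰ_ : Dual → ℕ → Dual
  x ^ᴰ zero  = ↑ (+ 1)
  x ^ᴰ suc k = x *ᴰ x ^ᴰ k

  prodᴰ : List Dual → Dual
  prodᴰ = foldr _*ᴰ_ (↑ (+ 1))

  -- evalᴰ c p = (p(c), p′(c)), by Horner's scheme at c + ε where ε² = 0.
  evalᴰ : ℤ → Poly → Dual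
  evalᴰ c []      = ↑ (+ 0)
  evalᴰ c (a ∷ p) = ↑ a +ᴰ (c +ε) *ᴰ evalᴰ c p

  eval : ℤ → Poly → ℤ
  eval c p = proj₁ (evalᴰ c p)

  +ᴰ-identityˡ : ∀ x → ↑ (+ 0) +ᴰ x ≡ x
  +ᴰ-identityˡ (a , a′) = cong₂ _,_ (ℤₚ.+-identityˡ a) (ℤₚ.+-identityˡ a′)

  +ᴰ-identityʳ : ∀ x → x +ᴰ ↑ (+ 0) ≡ x
  +ᴰ-identityʳ (a , a′) = cong₂ _,_ (ℤₚ.+-identityʳ a) (ℤₚ.+-identityʳ a′)

  *ᴰ-identityʳ : ∀ x → x *ᴰ ↑ (+ 1) ≡ x
  *ᴰ-identityʳ (a , a′) = cong₂ _,_ (ℤₚ.*-identityʳ a) (lemma a a′)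
    where
    lemma : ∀ a a′ → a * + 0 + a′ * + 1 ≡ a′
    lemma = solve-∀

  *ᴰ-zeroˡ : ∀ x → ↑ (+ 0) ≡ ↑ (+ 0) *ᴰ x
  *ᴰ-zeroˡ (a , a′) = cong₂ _,_ refl (lemma a a′)
    where
    lemma : ∀ a a′ → + 0 ≡ + 0 * a′ + + 0 * a
    lemma = solve-∀

  *ᴰ-zeroʳ : ∀ x → ↑ (+ 0) ≡ x *ᴰ ↑ (+ 0)
  *ᴰ-zeroʳ (a , a′) = cong₂ _,_ (lemma₁ a) (lemma₂ a a′)
    where
    lemma₁ : ∀ a → + 0 ≡ a * + 0
    lemma₁ = solve-∀
    lemma₂ : ∀ a a′ → + 0 ≡ a * + 0 + a′ * + 0
    lemma₂ = solve-∀

  horner-+ : ∀ a b t x y → ↑ (a + b) +ᴰ t *ᴰ (x +ᴰ y) ≡ (↑ a +ᴰ t *ᴰ x) +ᴰ (↑ b +ᴰ t *ᴰ y)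
  horner-+ a b (t , t′) (x , x′) (y , y′) = cong₂ _,_ (lemma₁ a b t x y) (lemma₂ t t′ x x′ y y′)
    where
    lemma₁ : ∀ a b t x y → a + b + t * (x + y) ≡ a + t * x + (b + t * y)
    lemma₁ = solve-∀
    lemma₂ : ∀ t t′ x x′ y y′ →
      + 0 + (t * (x′ + y′) + t′ * (x + y)) ≡ + 0 + (t * x′ + t′ * x) + (+ 0 + (t * y′ + t′ * y))
    lemma₂ = solve-∀

  horner-scale : ∀ a b t x → ↑ (a * b) +ᴰ t *ᴰ (↑ a *ᴰ x) ≡ ↑ a *ᴰ (↑ b +ᴰ t *ᴰ x)
  horner-scale a b (t , t′) (x , x′) = cong₂ _,_ (lemma₁ a b t x) (lemma₂ a b t t′ x x′)
    where
    lemma₁ : ∀ a b t x → a * b + t * (a * x) ≡ a * (b + t * x)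
    lemma₁ = solve-∀
    lemma₂ : ∀ a b t t′ x x′ →
      + 0 + (t * (a * x′ + + 0 * x) + t′ * (a * x)) ≡ a * (+ 0 + (t * x′ + t′ * x)) + + 0 * (b + t * x)
    lemma₂ = solve-∀

  horner-* : ∀ a t x y → ↑ a *ᴰ y +ᴰ (↑ (+ 0) +ᴰ t *ᴰ (x *ᴰ y)) ≡ (↑ a +ᴰ t *ᴰ x) *ᴰ y
  horner-* a (t , t′) (x , x′) (y , y′) = cong₂ _,_ (lemma₁ a t x y) (lemma₂ a t t′ x x′ y y′)
    where
    lemma₁ : ∀ a t x y → a * y + (+ 0 + t * (x * y)) ≡ (a + t * x) * y
    lemma₁ = solve-∀
    lemma₂ : ∀ a t t′ x x′ y y′ →
      a * y′ + + 0 * y + (+ 0 + (t * (x * y′ + x′ * y) + t′ * (x * y)))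
        ≡ (a + t * x) * y′ + (+ 0 + (t * x′ + t′ * x)) * y
    lemma₂ = solve-∀

  evalᴰ-const : ∀ c a → evalᴰ c (a ∷ []) ≡ ↑ a
  evalᴰ-const c a = cong₂ _,_ (lemma₁ a c) (lemma₂ c)
    where
    lemma₁ : ∀ a c → a + c * + 0 ≡ a
    lemma₁ = solve-∀
    lemma₂ : ∀ c → + 0 + (c * + 0 + + 1 * + 0) ≡ + 0
    lemma₂ = solve-∀

  evalᴰ-X : ∀ c → evalᴰ c X ≡ c +ε
  evalᴰ-X c = cong₂ _,_ (lemma₁ c) (lemma₂ c)
    where
    lemma₁ : ∀ c → + 0 + c * (+ 1 + c * + 0) ≡ c
    lemma₁ = solve-∀
    lemma₂ : ∀ c → + 0 + (c * (+ 0 + (c * + 0 + + 1 * + 0)) + + 1 * (+ 1 + c * + 0)) ≡ + 1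
    lemma₂ = solve-∀

  evalᴰ-+ₚ : ∀ c p q → evalᴰ c (p +ₚ q) ≡ evalᴰ c p +ᴰ evalᴰ c q
  evalᴰ-+ₚ c []      q       = sym (+ᴰ-identityˡ (evalᴰ c q))
  evalᴰ-+ₚ c (a ∷ p) []      = sym (+ᴰ-identityʳ (evalᴰ c (a ∷ p)))
  evalᴰ-+ₚ c (a ∷ p) (b ∷ q) = begin
    ↑ (a + b) +ᴰ (c +ε) *ᴰ evalᴰ c (p +ₚ q)               ≡⟨ cong (λ z → ↑ (a + b) +ᴰ (c +ε) *ᴰ z) (evalᴰ-+ₚ c p q) ⟩
    ↑ (a + b) +ᴰ (c +ε) *ᴰ (evalᴰ c p +ᴰ evalᴰ c q)       ≡⟨ horner-+ a b (c +ε) (evalᴰ c p) (evalᴰ c q) ⟩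
    evalᴰ c (a ∷ p) +ᴰ evalᴰ c (b ∷ q)                    ∎

  evalᴰ-scale : ∀ c a q → evalᴰ c (scale a q) ≡ ↑ a *ᴰ evalᴰ c q
  evalᴰ-scale c a []      = *ᴰ-zeroʳ (↑ a)
  evalᴰ-scale c a (b ∷ q) = begin
    ↑ (a * b) +ᴰ (c +ε) *ᴰ evalᴰ c (scale a q)   ≡⟨ cong (λ z → ↑ (a * b) +ᴰ (c +ε) *ᴰ z) (evalᴰ-scale c a q) ⟩
    ↑ (a * b) +ᴰ (c +ε) *ᴰ (↑ a *ᴰ evalᴰ c q)    ≡⟨ horner-scale a b (c +ε) (evalᴰ c q) ⟩
    ↑ a *ᴰ evalᴰ c (b ∷ q)                       ∎

  evalᴰ-*ₚ : ∀ c p q → evalᴰ c (p *ₚ q) ≡ evalᴰ c p *ᴰ evalᴰ c q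
  evalᴰ-*ₚ c []      q = *ᴰ-zeroˡ (evalᴰ c q)
  evalᴰ-*ₚ c (a ∷ p) q = begin
    evalᴰ c (scale a q +ₚ (+ 0 ∷ p *ₚ q))                       ≡⟨ evalᴰ-+ₚ c (scale a q) (+ 0 ∷ p *ₚ q) ⟩
    evalᴰ c (scale a q) +ᴰ evalᴰ c (+ 0 ∷ p *ₚ q)               ≡⟨ cong₂ (λ u v → u +ᴰ (↑ (+ 0) +ᴰ (c +ε) *ᴰ v))
                                                                       (evalᴰ-scale c a q) (evalᴰ-*ₚ c p q) ⟩
    ↑ a *ᴰ evalᴰ c q +ᴰ (↑ (+ 0) +ᴰ (c +ε) *ᴰ (evalᴰ c p *ᴰ evalᴰ c q)) ≡⟨ horner-* a (c +ε) (evalᴰ c p) (evalᴰ c q) ⟩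
    evalᴰ c (a ∷ p) *ᴰ evalᴰ c q                                ∎

  evalᴰ-^ₚ : ∀ c p k → evalᴰ c (p ^ₚ k) ≡ evalᴰ c p ^ᴰ k
  evalᴰ-^ₚ c p zero    = evalᴰ-const c (+ 1)
  evalᴰ-^ₚ c p (suc k) = trans (evalᴰ-*ₚ c p (p ^ₚ k)) (cong (evalᴰ c p *ᴰ_) (evalᴰ-^ₚ c p k))

  evalᴰ-prodₚ : ∀ c ps → evalᴰ c (prodₚ ps) ≡ prodᴰ (map (evalᴰ c) ps)
  evalᴰ-prodₚ c []       = evalᴰ-const c (+ 1)
  evalᴰ-prodₚ c (p ∷ ps) = trans (evalᴰ-*ₚ c p (prodₚ ps)) (cong (evalᴰ c p *ᴰ_) (evalᴰ-prodₚ c ps))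

  evalᴰ-zeros : ∀ c p → (∀ i → coeff p i ≡ + 0) → evalᴰ c p ≡ ↑ (+ 0)
  evalᴰ-zeros c []      _   = refl
  evalᴰ-zeros c (a ∷ p) p≡0 rewrite p≡0 0 | evalᴰ-zeros c p (λ i → p≡0 (suc i)) = evalᴰ-const c (+ 0)

  evalᴰ-cong : ∀ c {p q} → p ≈ₚ q → evalᴰ c p ≡ evalᴰ c q
  evalᴰ-cong c {[]}    {q}     p≈q = sym (evalᴰ-zeros c q (λ i → sym (p≈q i)))
  evalᴰ-cong c {a ∷ p} {[]}    p≈q = evalᴰ-zeros c (a ∷ p) p≈q
  evalᴰ-cong c {a ∷ p} {b ∷ q} p≈q =
    cong₂ (λ u v → ↑ u +ᴰ (c +ε) *ᴰ v) (p≈q 0) (evalᴰ-cong c {p} {q} (λ i → p≈q (suc i)))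

  eval-cong : ∀ c {p q} → p ≈ₚ q → eval c p ≡ eval c q
  eval-cong c {p} {q} p≈q = cong proj₁ (evalᴰ-cong c {p} {q} p≈q)

  power-rule : ∀ c k → (c +ε) ^ᴰ suc k ≡ (c ^ suc k , + suc k * c ^ k)
  power-rule c zero    = cong₂ _,_ refl (lemma c)
    where
    lemma : ∀ c → c * + 0 + + 1 * + 1 ≡ + 1 * + 1
    lemma = solve-∀
  power-rule c (suc k) =
    trans (cong ((c +ε) *ᴰ_) (power-rule c k)) (cong₂ _,_ refl (lemma c (+ suc k) (c ^ k)))
    where
    lemma : ∀ c n x → c * (n * x) + + 1 * (c * x) ≡ (+ 1 + n) * (c * x)
    lemma = solve-∀

  proj₁-^ᴰ : ∀ x k → proj₁ (x ^ᴰ k) ≡ proj₁ x ^ k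
  proj₁-^ᴰ x zero    = refl
  proj₁-^ᴰ x (suc k) = cong (proj₁ x *_) (proj₁-^ᴰ x k)

  proj₁-prodᴰ : ∀ xs → proj₁ (prodᴰ xs) ≡ product (map proj₁ xs)
  proj₁-prodᴰ []       = refl
  proj₁-prodᴰ (x ∷ xs) = cong (proj₁ x *_) (proj₁-prodᴰ xs)

module PrimeDivisors where
  open import Data.Nat using (zero; suc; _≤_; _*_; _^_; s≤s)
  import Data.Nat.Properties as ℕₚ
  open import Data.Nat.Divisibility
    using (_∣_; _∣?_; divides; ∣1⇒≡1; ∣-trans; m∣m*n; n∣m*n; *-cancelʳ-∣; *-monoˡ-∣)
  open import Data.Nat.Coprimality using (Coprime; coprime-divisor)
  open import Data.Nat.Primality using (Prime; prime⇒irreducible; prime⇒nonZero)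
  open import Data.Nat.Primality.Factorisation using (factorise)
  open import Data.Nat.ListAction using (product)
  open import Data.List using ([]; _∷_; length)
  open import Data.List.Relation.Unary.All using (All; []; _∷_)
  open import Data.Product using (∃-syntax; _×_; _,_)
  open import Data.Sum using (_⊎_; inj₁; inj₂)
  open import Data.Empty using (⊥-elim)
  open import Relation.Nullary using (yes; no; ¬_)
  open import Relation.Binary.PropositionalEquality

  prime∤⇒coprime : ∀ {p d} → Prime p → ¬ p ∣ d → Coprime d p
  prime∤⇒coprime pp p∤d (i∣d , i∣p) with prime⇒irreducible pp i∣p
  ... | inj₁ i≡1 = i≡1
  ... | inj₂ refl = ⊥-elim (p∤d i∣d)

  ∣p^suc⇒∣p^⊎≡p^suc : ∀ {p d} a → Prime p → d ∣ p ^ suc a → d ∣ p ^ a ⊎ d ≡ p ^ suc a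
  ∣p^suc⇒∣p^⊎≡p^suc {p} {d} a pp d∣p^suc with p ∣? d
  ... | no  p∤d = inj₁ (coprime-divisor (prime∤⇒coprime pp p∤d) d∣p^suc)
  ... | yes (divides q refl) =
    multiply a (*-cancelʳ-∣ p {{prime⇒nonZero pp}} (subst (q * p ∣_) (ℕₚ.*-comm p (p ^ a)) d∣p^suc))
    where
    multiply : ∀ a → q ∣ p ^ a → q * p ∣ p ^ a ⊎ q * p ≡ p ^ suc a
    multiply zero    q∣1 rewrite ∣1⇒≡1 q∣1 = inj₂ (ℕₚ.*-comm 1 p)
    multiply (suc a) q∣p^suc with ∣p^suc⇒∣p^⊎≡p^suc a pp q∣p^suc
    ... | inj₁ q∣p^a = inj₁ (subst (q * p ∣_) (ℕₚ.*-comm (p ^ a) p) (*-monoˡ-∣ p q∣p^a))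
    ... | inj₂ q≡p^suc = inj₂ (trans (cong (_* p) q≡p^suc) (ℕₚ.*-comm (p ^ suc a) p))

  product≡power⊎other-prime : ∀ p ps → All Prime ps →
    product ps ≡ p ^ length ps ⊎ ∃[ q ] Prime q × q ≢ p × q ∣ product ps
  product≡power⊎other-prime p []       []          = inj₁ refl
  product≡power⊎other-prime p (q ∷ qs) (pq ∷ pqs) with q ℕₚ.≟ p
  ... | no  q≢p  = inj₂ (q , pq , q≢p , m∣m*n (product qs))
  ... | yes refl with product≡power⊎other-prime p qs pqs
  ...   | inj₁ qs≡p^ = inj₁ (cong (p *_) qs≡p^)
  ...   | inj₂ (r , pr , r≢p , r∣qs) = inj₂ (r , pr , r≢p , ∣-trans r∣qs (n∣m*n p))

  two-prime-divisors : ∀ {e} → 2 ≤ e → (∀ p a → Prime p → e ≢ p ^ suc a) →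
    ∃[ p ] ∃[ q ] Prime p × Prime q × q ≢ p × p ∣ e × q ∣ e
  two-prime-divisors {suc zero} (s≤s ())
  two-prime-divisors {suc (suc k)} _ not-prime-power with factorise (suc (suc k))
  ... | record { factors = [] ; isFactorisation = () }
  ... | record { factors = p ∷ ps ; isFactorisation = e≡ ; factorsPrime = pp ∷ pps }
    with product≡power⊎other-prime p (p ∷ ps) (pp ∷ pps)
  ...   | inj₁ e≡p^ = ⊥-elim (not-prime-power p (length ps) pp (trans e≡ e≡p^))
  ...   | inj₂ (q , pq , q≢p , q∣) =
    p , q , pp , pq , q≢p , subst (p ∣_) (sym e≡) (m∣m*n (product ps)) , subst (q ∣_) (sym e≡) q∣

module DivisorProductInversion where
  open import Data.Nat as ℕ using (ℕ; zero; suc; _≤_; _<_; z≤n; s≤s; nonTrivial⇒n>1)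
  import Data.Nat.Properties as ℕₚ
  open import Data.Nat.Induction using (<-rec)
  open import Data.Nat.Divisibility using (_∣_; divides; >⇒∤)
  open import Data.Nat.Primality using (Prime; prime⇒irreducible; prime⇒nonZero; prime⇒nonTrivial; ¬prime[1])
  open import Data.Integer using (ℤ; +_; -[1+_]; _*_; ∣_∣)
  import Data.Integer.Properties as ℤₚ
  open import Data.Product using (∃-syntax; _,_)
  open import Data.Sum using (inj₁; inj₂)
  open import Data.Empty using (⊥-elim)
  open import Relation.Binary.PropositionalEquality
  open ≡-Reasoning
  open Products
  open PrimeDivisors using (∣p^suc⇒∣p^⊎≡p^suc; two-prime-divisors)

  ∏⁺∣≡1⇒≡1 : (C : ℕ → Set) → (∀ {m d} → C m → d ∣ m → C d) → (f : ℕ → ℤ) →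
    (∀ m → 2 ≤ m → C m → ∏⁺∣ m f ≡ + 1) → ∀ m → 2 ≤ m → C m → f m ≡ + 1
  ∏⁺∣≡1⇒≡1 C C-∣ f ∏⁺∣≡1 = <-rec (λ m → 2 ≤ m → C m → f m ≡ + 1) step
    where
    step : ∀ m → (∀ {d} → d < m → 2 ≤ d → C d → f d ≡ + 1) → 2 ≤ m → C m → f m ≡ + 1
    step 1             _    (s≤s ())
    step (suc (suc k)) f<≡1 2≤m Cm = begin
      f m                                           ≡⟨ ℤₚ.*-identityˡ (f m) ⟨
      + 1 * f m                                     ≡⟨ cong (_* f m) proper≡1 ⟨
      ∏[ i < k ] whenDivides m f (2 ℕ.+ i) * f m    ≡⟨ ∏⁺∣-last k f ⟨
      ∏⁺∣ m f                                       ≡⟨ ∏⁺∣≡1 m 2≤m Cm ⟩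
      + 1                                           ∎
      where
      m = 2 ℕ.+ k
      proper≡1 : ∏[ i < k ] whenDivides m f (2 ℕ.+ i) ≡ + 1
      proper≡1 = ∏<-one k (λ i i<k → whenDivides-preserves (_≡ + 1) m f (2 ℕ.+ i) refl
                   (λ d∣m → f<≡1 (s≤s (s≤s i<k)) (s≤s (s≤s z≤n)) (C-∣ Cm d∣m)))

  positive-factor : ∀ a w n → + suc a * w ≡ + suc n → ∃[ t ] w ≡ + suc t
  positive-factor a (+ zero)  n eq with () ← trans (sym (ℤₚ.*-zeroʳ (+ suc a))) eq
  positive-factor a (+ suc t) n _  = t , refl
  positive-factor a -[1+ t ]  n ()

  -- The hypothesis forces W = exp ∘ Λ (von Mangoldt's function): p on powers of a prime p, 1 elsewhere.
  module _ (W : ℕ → ℤ) (∏⁺∣W≡ : ∀ e → 1 ≤ e → ∏⁺∣ e W ≡ + e) where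

    W-positive : ∀ e → 2 ≤ e → ∃[ t ] W e ≡ + suc t
    W-positive = <-rec (λ e → 2 ≤ e → ∃[ t ] W e ≡ + suc t) step
      where
      step : ∀ e → (∀ {d} → d < e → 2 ≤ d → ∃[ t ] W d ≡ + suc t) → 2 ≤ e → ∃[ t ] W e ≡ + suc t
      step 1             _      (s≤s ())
      step (suc (suc k)) W<-pos _ with ∏<-positive k (λ i → whenDivides (2 ℕ.+ k) W (2 ℕ.+ i)) (λ i i<k →
          whenDivides-preserves (λ z → ∃[ t ] z ≡ + suc t) (2 ℕ.+ k) W (2 ℕ.+ i) (0 , refl)
            (λ _ → W<-pos (s≤s (s≤s i<k)) (s≤s (s≤s z≤n))))
      ... | a , proper≡ = positive-factor a (W (2 ℕ.+ k)) (suc k) (begin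
        + suc a * W (2 ℕ.+ k)                                       ≡⟨ cong (_* W (2 ℕ.+ k)) proper≡ ⟨
        ∏[ i < k ] whenDivides (2 ℕ.+ k) W (2 ℕ.+ i) * W (2 ℕ.+ k)  ≡⟨ ∏⁺∣-last k W ⟨
        ∏⁺∣ (2 ℕ.+ k) W                                             ≡⟨ ∏⁺∣W≡ (2 ℕ.+ k) (s≤s z≤n) ⟩
        + (2 ℕ.+ k)                                                 ∎)

    -- Dividing ∏⁺∣ e W = e by ∏⁺∣ c W = c leaves r as a product over the divisors of e
    -- that do not divide c, among them e itself.
    cofactor-product : ∀ {c r} k → 1 ≤ c → c < 2 ℕ.+ k → 2 ℕ.+ k ≡ c ℕ.* r →
      ∏[ i < k ] whenDivides (2 ℕ.+ k) (unlessDivides c W) (2 ℕ.+ i) * W (2 ℕ.+ k) ≡ + r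
    cofactor-product {suc c} {r} k 1≤c c<e e≡cr = ℤₚ.*-cancelˡ-≡ (+ suc c) _ _ (begin
      + suc c * (proper * W e)                        ≡⟨ cong₂ _*_ (∏⁺∣W≡ (suc c) 1≤c)
                                                          (cong (proper *_) (unlessDivides-∤ W (>⇒∤ c<e))) ⟨
      ∏⁺∣ (suc c) W * (proper * unlessDivides (suc c) W e) ≡⟨ cong (∏⁺∣ (suc c) W *_) (∏⁺∣-last k (unlessDivides (suc c) W)) ⟨
      ∏⁺∣ (suc c) W * ∏⁺∣ e (unlessDivides (suc c) W) ≡⟨ ∏⁺∣-split W 1≤c c∣e (s≤s z≤n) ⟨
      ∏⁺∣ e W                                         ≡⟨ ∏⁺∣W≡ e (s≤s z≤n) ⟩
      + e                                             ≡⟨ cong +_ e≡cr ⟩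
      + (suc c ℕ.* r)                                 ≡⟨ ℤₚ.pos-* (suc c) r ⟩
      + suc c * + r                                   ∎)
      where
      e = 2 ℕ.+ k
      proper = ∏[ i < k ] whenDivides e (unlessDivides (suc c) W) (2 ℕ.+ i)
      c∣e : suc c ∣ e
      c∣e = divides r (trans e≡cr (ℕₚ.*-comm (suc c) r))

    W≡cofactor : ∀ {c r} k → 1 ≤ c → c < 2 ℕ.+ k → 2 ℕ.+ k ≡ c ℕ.* r →
      (∀ {d} → d < 2 ℕ.+ k → d ∣ 2 ℕ.+ k → d ∣ c) → W (2 ℕ.+ k) ≡ + r
    W≡cofactor {c} {r} k 1≤c c<e e≡cr proper∣c = begin
      W e                ≡⟨ ℤₚ.*-identityˡ (W e) ⟨
      + 1 * W e          ≡⟨ cong (_* W e) proper≡1 ⟨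
      proper * W e       ≡⟨ cofactor-product k 1≤c c<e e≡cr ⟩
      + r                ∎
      where
      e = 2 ℕ.+ k
      proper = ∏[ i < k ] whenDivides e (unlessDivides c W) (2 ℕ.+ i)
      proper≡1 : proper ≡ + 1
      proper≡1 = ∏<-one k (λ i i<k → whenDivides-preserves (_≡ + 1) e (unlessDivides c W) (2 ℕ.+ i) refl
                   (λ d∣e → unlessDivides-∣ W (proper∣c (s≤s (s≤s i<k)) d∣e)))

    W∣cofactor : ∀ {c r t} k → 1 ≤ c → c < 2 ℕ.+ k → 2 ℕ.+ k ≡ c ℕ.* r →
      W (2 ℕ.+ k) ≡ + suc t → suc t ∣ r
    W∣cofactor {c} {r} {t} k 1≤c c<e e≡cr W≡ =
      divides ∣ proper ∣ (trans (cong ∣_∣ (sym proper*t≡r)) (ℤₚ.abs-* proper (+ suc t)))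
      where
      proper = ∏[ i < k ] whenDivides (2 ℕ.+ k) (unlessDivides c W) (2 ℕ.+ i)
      proper*t≡r : proper * + suc t ≡ + r
      proper*t≡r = trans (cong (proper *_) (sym W≡)) (cofactor-product k 1≤c c<e e≡cr)

    W∣prime : ∀ {r t} k → Prime r → r ∣ 2 ℕ.+ k → W (2 ℕ.+ k) ≡ + suc t → suc t ∣ r
    W∣prime k pr (divides (suc c) e≡cr) =
      W∣cofactor k (s≤s z≤n)
        (subst (suc c <_) (sym e≡cr) (ℕₚ.m<m*n (suc c) _ (nonTrivial⇒n>1 _ {{prime⇒nonTrivial pr}})))
        e≡cr

    W-prime-power : ∀ {p} a → Prime p → W (p ℕ.^ suc a) ≡ + p
    W-prime-power {p} a pp = at (ℕₚ.^-monoʳ-< p 1<p {0} {suc a} (s≤s z≤n)) refl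
      where
      1<p : 1 < p
      1<p = nonTrivial⇒n>1 p {{prime⇒nonTrivial pp}}
      at : ∀ {e} → 1 < e → e ≡ p ℕ.^ suc a → W e ≡ + p
      at {suc zero}    (s≤s ()) _
      at {suc (suc k)} _        e≡p^suc =
        W≡cofactor k (ℕₚ.m^n>0 p {{prime⇒nonZero pp}} a)
          (subst (p ℕ.^ a <_) (sym e≡p^suc) (ℕₚ.^-monoʳ-< p 1<p {a} {suc a} (ℕₚ.n<1+n a)))
          (trans e≡p^suc (ℕₚ.*-comm p (p ℕ.^ a))) proper∣p^a
        where
        proper∣p^a : ∀ {d} → d < 2 ℕ.+ k → d ∣ 2 ℕ.+ k → d ∣ p ℕ.^ a
        proper∣p^a {d} d<e d∣e with ∣p^suc⇒∣p^⊎≡p^suc a pp (subst (d ∣_) e≡p^suc d∣e)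
        ... | inj₁ d∣p^a   = d∣p^a
        ... | inj₂ d≡p^suc = ⊥-elim (ℕₚ.<⇒≢ d<e (trans d≡p^suc (sym e≡p^suc)))

    W-not-prime-power : ∀ e → 2 ≤ e → (∀ p a → Prime p → e ≢ p ℕ.^ suc a) → W e ≡ + 1
    W-not-prime-power (suc zero)    (s≤s ()) _
    W-not-prime-power (suc (suc k)) 2≤e not-prime-power
      with two-prime-divisors 2≤e not-prime-power | W-positive (2 ℕ.+ k) 2≤e
    ... | p , q , pp , pq , q≢p , p∣e , q∣e | t , W≡
      with prime⇒irreducible pp (W∣prime k pp p∣e W≡) | prime⇒irreducible pq (W∣prime k pq q∣e W≡)
    ...   | inj₁ refl | _         = W≡
    ...   | inj₂ t≡p  | inj₁ t≡1  = ⊥-elim (¬prime[1] (subst Prime (trans (sym t≡p) t≡1) pp))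
    ...   | inj₂ t≡p  | inj₂ t≡q  = ⊥-elim (q≢p (trans (sym t≡q) t≡p))

module Parity where
  open import Data.Nat as ℕ using (zero; suc)
  import Data.Nat.Properties as ℕₚ
  open import Data.Nat.Divisibility using (_∣_; _∣0; ∣-refl; ∣1⇒≡1; m∣m*n; ∣m+n∣m⇒∣n; ∣m∣n⇒∣m+n)
  open import Data.Integer using (+_; -_; _*_; _^_)
  open import Data.Empty using (⊥-elim)
  open import Relation.Nullary using (¬_)
  open import Relation.Binary.PropositionalEquality

  ¬2∣1+2* : ∀ n → ¬ 2 ∣ suc (2 ℕ.* n)
  ¬2∣1+2* n 2∣1+2n with ∣1⇒≡1 (∣m+n∣m⇒∣n (subst (2 ∣_) (ℕₚ.+-comm 1 (2 ℕ.* n)) 2∣1+2n) (m∣m*n n))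
  ... | ()

  -1^odd : ∀ m → ¬ 2 ∣ m → (- + 1) ^ m ≡ - + 1
  -1^odd zero          odd = ⊥-elim (odd (2 ∣0))
  -1^odd (suc zero)    _   = refl
  -1^odd (suc (suc m)) odd =
    cong (λ z → - + 1 * (- + 1 * z)) (-1^odd m (λ 2∣m → odd (∣m∣n⇒∣m+n ∣-refl 2∣m)))

module CyclotomicValues (Φ : ℕ → Poly) (isΦ : IsCyclotomicFamily Φ) where
  open import Data.Nat as ℕ using (ℕ; zero; suc; _≤_; z≤n; s≤s)
  import Data.Nat.Properties as ℕₚ
  open import Data.Nat.Divisibility using (_∣_; _∣?_; divides; ∣-refl; ∣-trans; m∣m*n; ∣m∣n⇒∣m+n)
  open import Data.Nat.Primality using (Prime)
  open import Data.Integer using (+_; -_; _+_; _-_; _*_; _^_; NonZero)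
  import Data.Integer.Properties as ℤₚ
  open import Data.Integer.Tactic.RingSolver using (solve-∀)
  open import Data.Product using (_×_; _,_; proj₁; proj₂; ∃-syntax)
  open import Data.List using (_∷_; []; map)
  import Data.List.Properties as Listₚ
  open import Data.Unit using (⊤; tt)
  open import Function using (_∘_)
  open import Relation.Nullary using (¬_; yes; no)
  open import Relation.Binary.PropositionalEquality
  open ≡-Reasoning
  open Products
  open DualNumbers
  open DivisorProductInversion using (∏⁺∣≡1⇒≡1; W-prime-power; W-not-prime-power)
  open Parity using (¬2∣1+2*; -1^odd)

  divisor-productᴰ : ∀ c m → 1 ≤ m → prodᴰ (map (evalᴰ c ∘ Φ) (divisors m)) ≡ (c +ε) ^ᴰ m +ᴰ ↑ (- + 1)
  divisor-productᴰ c m 1≤m = begin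
    prodᴰ (map (evalᴰ c ∘ Φ) (divisors m))       ≡⟨ cong prodᴰ (Listₚ.map-∘ (divisors m)) ⟩
    prodᴰ (map (evalᴰ c) (map Φ (divisors m)))   ≡⟨ evalᴰ-prodₚ c (map Φ (divisors m)) ⟨
    evalᴰ c (prodₚ (map Φ (divisors m)))         ≡⟨ evalᴰ-cong c (isΦ m 1≤m) ⟩
    evalᴰ c (Xpow-1 m)                           ≡⟨ evalᴰ-+ₚ c (X ^ₚ m) (- + 1 ∷ []) ⟩
    evalᴰ c (X ^ₚ m) +ᴰ evalᴰ c (- + 1 ∷ [])     ≡⟨ cong₂ _+ᴰ_ (trans (evalᴰ-^ₚ c X m) (cong (_^ᴰ m) (evalᴰ-X c)))
                                                              (evalᴰ-const c (- + 1)) ⟩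
    (c +ε) ^ᴰ m +ᴰ ↑ (- + 1)                     ∎

  divisor-product : ∀ c k → product (map (eval c ∘ Φ) (divisors (suc k))) ≡ c ^ suc k - + 1
  divisor-product c k = begin
    product (map (eval c ∘ Φ) ds)                   ≡⟨ cong product (Listₚ.map-∘ ds) ⟩
    product (map proj₁ (map (evalᴰ c ∘ Φ) ds))      ≡⟨ proj₁-prodᴰ (map (evalᴰ c ∘ Φ) ds) ⟨
    proj₁ (prodᴰ (map (evalᴰ c ∘ Φ) ds))            ≡⟨ cong proj₁ (divisor-productᴰ c (suc k) (s≤s z≤n)) ⟩
    proj₁ ((c +ε) ^ᴰ suc k +ᴰ ↑ (- + 1))            ≡⟨ cong (λ x → proj₁ (x +ᴰ ↑ (- + 1))) (power-rule c k) ⟩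
    c ^ suc k - + 1                                 ∎
    where
    ds = divisors (suc k)

  Φ₁-at : ∀ c → eval c (Φ 1) ≡ c - + 1
  Φ₁-at c = begin
    eval c (Φ 1)            ≡⟨ ℤₚ.*-identityʳ (eval c (Φ 1)) ⟨
    eval c (Φ 1) * + 1      ≡⟨ divisor-product c 0 ⟩
    c ^ 1 - + 1             ≡⟨ cong (_- + 1) (ℤₚ.^-identityʳ c) ⟩
    c - + 1                 ∎

  ∏⁺∣-at-fixed-point : ∀ c k .{{_ : NonZero (c - + 1)}} → c ^ suc k ≡ c → ∏⁺∣ (suc k) (eval c ∘ Φ) ≡ + 1
  ∏⁺∣-at-fixed-point c k c^≡c = ℤₚ.*-cancelˡ-≡ (c - + 1) _ _ (begin
    (c - + 1) * ∏⁺∣ (suc k) f              ≡⟨ cong (_* ∏⁺∣ (suc k) f) (Φ₁-at c) ⟨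
    f 1 * ∏⁺∣ (suc k) f                    ≡⟨ product-divisors k f ⟨
    product (map f (divisors (suc k)))     ≡⟨ divisor-product c k ⟩
    c ^ suc k - + 1                        ≡⟨ cong (_- + 1) c^≡c ⟩
    c - + 1                                ≡⟨ ℤₚ.*-identityʳ (c - + 1) ⟨
    (c - + 1) * + 1                        ∎)
    where
    f = eval c ∘ Φ

  Φ-at-0 : ∀ m → 2 ≤ m → eval (+ 0) (Φ m) ≡ + 1
  Φ-at-0 m 2≤m = ∏⁺∣≡1⇒≡1 (λ _ → ⊤) _ (eval (+ 0) ∘ Φ) ∏⁺∣≡1 m 2≤m tt
    where
    ∏⁺∣≡1 : ∀ m → 2 ≤ m → ⊤ → ∏⁺∣ m (eval (+ 0) ∘ Φ) ≡ + 1
    ∏⁺∣≡1 (suc k) _ _ = ∏⁺∣-at-fixed-point (+ 0) k (ℤₚ.*-zeroˡ ((+ 0) ^ k))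

  Φ-at-−1-odd : ∀ m → 2 ≤ m → ¬ 2 ∣ m → eval (- + 1) (Φ m) ≡ + 1
  Φ-at-−1-odd =
    ∏⁺∣≡1⇒≡1 (λ m → ¬ 2 ∣ m) (λ m-odd d∣m 2∣d → m-odd (∣-trans 2∣d d∣m)) (eval (- + 1) ∘ Φ) ∏⁺∣≡1
    where
    ∏⁺∣≡1 : ∀ m → 2 ≤ m → ¬ 2 ∣ m → ∏⁺∣ m (eval (- + 1) ∘ Φ) ≡ + 1
    ∏⁺∣≡1 (suc k) _ m-odd = ∏⁺∣-at-fixed-point (- + 1) k (-1^odd (suc k) m-odd)

  Φ₁-at-−1ᴰ : evalᴰ (- + 1) (Φ 1) ≡ (- + 2 , + 1)
  Φ₁-at-−1ᴰ = trans (sym (*ᴰ-identityʳ (evalᴰ (- + 1) (Φ 1)))) (divisor-productᴰ (- + 1) 1 (s≤s z≤n))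

  Φ₂-at-−1ᴰ : evalᴰ (- + 1) (Φ 2) ≡ (+ 0 , + 1)
  Φ₂-at-−1ᴰ = cancel (evalᴰ (- + 1) (Φ 2)) (begin
    (- + 2 , + 1) *ᴰ Φ₂ᴰ                        ≡⟨ cong₂ _*ᴰ_ Φ₁-at-−1ᴰ (*ᴰ-identityʳ Φ₂ᴰ) ⟨
    evalᴰ (- + 1) (Φ 1) *ᴰ (Φ₂ᴰ *ᴰ ↑ (+ 1))     ≡⟨ divisor-productᴰ (- + 1) 2 (s≤s z≤n) ⟩
    (+ 0 , - + 2)                               ∎)
    where
    Φ₂ᴰ = evalᴰ (- + 1) (Φ 2)
    cancel : ∀ x → (- + 2 , + 1) *ᴰ x ≡ (+ 0 , - + 2) → x ≡ (+ 0 , + 1)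
    cancel (a , b) eq with ℤₚ.*-cancelˡ-≡ (- + 2) a (+ 0) (cong proj₁ eq)
    ... | refl = cong (+ 0 ,_)
      (ℤₚ.*-cancelˡ-≡ (- + 2) b (+ 1) (trans (sym (ℤₚ.+-identityʳ (- + 2 * b))) (cong proj₂ eq)))

  -- Differentiating (q² - 1) ∏_{3 ≤ d ∣ m} Φ_d(q) = q^m - 1 at q = -1, for m = 2 + 2k even,
  -- gives -2 ∏_{3 ≤ d ∣ m} Φ_d(-1) = -m.
  product-divisors≥3-twice-at-−1 : ∀ k → product (map (eval (- + 1) ∘ Φ) (divisors≥3 (2 ℕ.+ 2 ℕ.* k))) ≡ + suc k
  product-divisors≥3-twice-at-−1 k = begin
    product (map (eval (- + 1) ∘ Φ) ds)    ≡⟨ cong product (Listₚ.map-∘ ds) ⟩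
    product (map proj₁ (map F ds))          ≡⟨ proj₁-prodᴰ (map F ds) ⟨
    proj₁ R                                 ≡⟨ ℤₚ.*-cancelˡ-≡ (- + 2) (proj₁ R) (+ suc k) -2*R≡-2*[1+k] ⟩
    + suc k                                 ∎
    where
    m = 2 ℕ.+ 2 ℕ.* k
    F = evalᴰ (- + 1) ∘ Φ
    ds = divisors≥3 m
    R = prodᴰ (map F ds)

    ε-lhs : ∀ r r′ → proj₂ ((- + 2 , + 1) *ᴰ ((+ 0 , + 1) *ᴰ (r , r′))) ≡ - + 2 * r
    ε-lhs = lemma
      where
      lemma : ∀ r r′ → - + 2 * (+ 0 * r′ + + 1 * r) + + 1 * (+ 0 * r) ≡ - + 2 * r
      lemma = solve-∀

    ε-rhs : proj₂ (((- + 1) +ε) ^ᴰ m +ᴰ ↑ (- + 1)) ≡ - + 2 * + suc k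
    ε-rhs = begin
      proj₂ (((- + 1) +ε) ^ᴰ m +ᴰ ↑ (- + 1))  ≡⟨ cong (λ x → proj₂ (x +ᴰ ↑ (- + 1))) (power-rule (- + 1) (suc (2 ℕ.* k))) ⟩
      + m * (- + 1) ^ suc (2 ℕ.* k) + + 0     ≡⟨ cong (λ z → + m * z + + 0) (-1^odd (suc (2 ℕ.* k)) (¬2∣1+2* k)) ⟩
      + m * - + 1 + + 0                        ≡⟨ cong (λ n → + n * - + 1 + + 0) (ℕₚ.*-suc 2 k) ⟨
      + (2 ℕ.* suc k) * - + 1 + + 0            ≡⟨ cong (λ z → z * - + 1 + + 0) (ℤₚ.pos-* 2 (suc k)) ⟩
      + 2 * + suc k * - + 1 + + 0              ≡⟨ negate (+ suc k) ⟩
      - + 2 * + suc k                          ∎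
      where
      negate : ∀ n → + 2 * n * - + 1 + + 0 ≡ - + 2 * n
      negate = solve-∀

    -2*R≡-2*[1+k] : - + 2 * proj₁ R ≡ - + 2 * + suc k
    -2*R≡-2*[1+k] = begin
      - + 2 * proj₁ R                                    ≡⟨ ε-lhs (proj₁ R) (proj₂ R) ⟨
      proj₂ ((- + 2 , + 1) *ᴰ ((+ 0 , + 1) *ᴰ R))        ≡⟨ cong (λ x → proj₂ (x *ᴰ ((+ 0 , + 1) *ᴰ R))) Φ₁-at-−1ᴰ ⟨
      proj₂ (F 1 *ᴰ ((+ 0 , + 1) *ᴰ R))                  ≡⟨ cong (λ x → proj₂ (F 1 *ᴰ (x *ᴰ R))) Φ₂-at-−1ᴰ ⟨
      proj₂ (prodᴰ (map F (1 ∷ 2 ∷ ds)))                 ≡⟨ cong (λ ds → proj₂ (prodᴰ (map F ds))) divisors≡ ⟨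
      proj₂ (prodᴰ (map F (divisors m)))                 ≡⟨ cong proj₂ (divisor-productᴰ (- + 1) m (s≤s z≤n)) ⟩
      proj₂ (((- + 1) +ε) ^ᴰ m +ᴰ ↑ (- + 1))             ≡⟨ ε-rhs ⟩
      - + 2 * + suc k                                    ∎
      where
      divisors≡ : divisors m ≡ 1 ∷ 2 ∷ ds
      divisors≡ = divisors-2+ (2 ℕ.* k) (∣m∣n⇒∣m+n ∣-refl (m∣m*n k))

  ∏⁺∣-Φ-twice-at-−1 : ∀ e → 1 ≤ e → ∏⁺∣ e (λ d → eval (- + 1) (Φ (2 ℕ.* d))) ≡ + e
  ∏⁺∣-Φ-twice-at-−1 (suc k) _ =
    trans (sym (product-divisors≥3-even k (eval (- + 1) ∘ Φ) odd≡1)) (product-divisors≥3-twice-at-−1 k)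
    where
    odd≡1 : ∀ i → eval (- + 1) (Φ (3 ℕ.+ 2 ℕ.* i)) ≡ + 1
    odd≡1 i = Φ-at-−1-odd (3 ℕ.+ 2 ℕ.* i) (s≤s (s≤s z≤n))
                (subst (λ n → ¬ 2 ∣ n) (cong suc (ℕₚ.*-suc 2 i)) (¬2∣1+2* (suc i)))

  Φ-at-−1-twice-prime-power : ∀ {n p m} → Prime p → 1 ≤ m → n ≡ 2 ℕ.* p ℕ.^ m → eval (- + 1) (Φ n) ≡ + p
  Φ-at-−1-twice-prime-power {p = p} {suc a} pp _ n≡ =
    subst (λ n → eval (- + 1) (Φ n) ≡ + p) (sym n≡) (W-prime-power _ ∏⁺∣-Φ-twice-at-−1 a pp)

  Φ-at-−1-otherwise : ∀ n → 3 ≤ n → ¬ (∃[ p ] ∃[ m ] (Prime p × 1 ≤ m × n ≡ 2 ℕ.* p ℕ.^ m)) →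
    eval (- + 1) (Φ n) ≡ + 1
  Φ-at-−1-otherwise n 3≤n not-twice-prime-power with 2 ∣? n
  ... | no  n-odd = Φ-at-−1-odd n (ℕₚ.<⇒≤ 3≤n) n-odd
  ... | yes (divides e n≡e*2) =
    subst (λ n → eval (- + 1) (Φ n) ≡ + 1) (sym n≡2*e)
      (W-not-prime-power _ ∏⁺∣-Φ-twice-at-−1 e (half≥2 e (subst (3 ≤_) n≡e*2 3≤n)) not-prime-power)
    where
    n≡2*e : n ≡ 2 ℕ.* e
    n≡2*e = trans n≡e*2 (ℕₚ.*-comm e 2)
    half≥2 : ∀ e → 3 ≤ e ℕ.* 2 → 2 ≤ e
    half≥2 (suc zero)    (s≤s (s≤s ()))
    half≥2 (suc (suc e)) _ = s≤s (s≤s z≤n)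
    not-prime-power : ∀ p a → Prime p → e ≢ p ℕ.^ suc a
    not-prime-power p a pp e≡p^ = not-twice-prime-power (p , suc a , pp , s≤s z≤n , trans n≡2*e (cong (2 ℕ.*_) e≡p^))

module LucasExpansion where
  open import Data.Nat as ℕ using (ℕ; zero; suc; _≤_; _<_; _∸_; z≤n; s≤s; NonZero)
  import Data.Nat.Properties as ℕₚ
  open import Data.Nat.DivMod using (_%_; _/_; m≡m%n+[m/n]*n; m%n<n; m/n*n≤m)
  open import Data.Integer using (ℤ; +_; -_; _+_; _*_; _^_)
  import Data.Integer.Properties as ℤₚ
  open import Data.List using (List; []; _∷_; foldr; map; applyUpTo; upTo)
  import Data.List.Properties as Listₚ
  open import Data.Product using (proj₁)
  open import Data.Sum as Sum using (_⊎_; inj₁; inj₂)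
  open import Data.Empty using (⊥-elim)
  open import Relation.Nullary using (contradiction)
  open import Function using (_∘_)
  open import Relation.Binary.PropositionalEquality
  open ≡-Reasoning
  open DualNumbers

  ∑ : List ℤ → ℤ
  ∑ = foldr _+_ (+ 0)

  ∑-zeros : ∀ k f → (∀ j → j < k → f j ≡ + 0) → ∑ (applyUpTo f k) ≡ + 0
  ∑-zeros zero    f _   = refl
  ∑-zeros (suc k) f f≡0 =
    cong₂ _+_ (f≡0 0 (s≤s z≤n)) (∑-zeros k (λ j → f (suc j)) (λ j j<k → f≡0 (suc j) (s≤s j<k)))

  ∑-single : ∀ k f i → i < k → (∀ j → j < k → j ≢ i → f j ≡ + 0) → ∑ (applyUpTo f k) ≡ f i
  ∑-single (suc k) f zero    _         f≡0 = trans (cong (_+_ (f 0)) (∑-zeros k (λ j → f (suc j))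
    (λ j j<k → f≡0 (suc j) (s≤s j<k) (λ ())))) (ℤₚ.+-identityʳ (f 0))
  ∑-single (suc k) f (suc i) (s≤s i<k) f≡0 = trans (cong₂ _+_ (f≡0 0 (s≤s z≤n) (λ ()))
    (∑-single k (λ j → f (suc j)) i i<k (λ j j<k j≢i → f≡0 (suc j) (s≤s j<k) (λ { refl → j≢i refl }))))
    (ℤₚ.+-identityˡ (f (suc i)))

  eval-sumₚ : ∀ c ps → eval c (sumₚ ps) ≡ ∑ (map (eval c) ps)
  eval-sumₚ c []       = refl
  eval-sumₚ c (p ∷ ps) = trans (cong proj₁ (evalᴰ-+ₚ c p (sumₚ ps))) (cong (_+_ (eval c p)) (eval-sumₚ c ps))

  eval-^ₚ : ∀ c p k → eval c (p ^ₚ k) ≡ eval c p ^ k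
  eval-^ₚ c p k = trans (cong proj₁ (evalᴰ-^ₚ c p k)) (proj₁-^ᴰ (evalᴰ c p) k)

  lucasTermAt : ℕ → (ℕ → ℤ) → ℕ → ℤ → ℤ
  lucasTermAt n γ j c = γ j * (c ^ j * (+ 1 + c) ^ (totient n ∸ 2 ℕ.* j))

  eval-lucasExpansion : ∀ c n γ →
    eval c (lucasExpansion n γ) ≡ ∑ (applyUpTo (λ j → lucasTermAt n γ j c) (suc (totient n / 2)))
  eval-lucasExpansion c n γ = begin
    eval c (lucasExpansion n γ)                     ≡⟨ eval-sumₚ c (map term (upTo (suc K))) ⟩
    ∑ (map (eval c) (map term (upTo (suc K))))      ≡⟨ cong ∑ (Listₚ.map-∘ {g = eval c} {f = term} (upTo (suc K))) ⟨
    ∑ (map (eval c ∘ term) (upTo (suc K)))          ≡⟨ cong ∑ (Listₚ.map-cong eval-term (upTo (suc K))) ⟩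
    ∑ (map (λ j → lucasTermAt n γ j c) (upTo (suc K))) ≡⟨ cong ∑ (Listₚ.map-upTo (λ j → lucasTermAt n γ j c) (suc K)) ⟩
    ∑ (applyUpTo (λ j → lucasTermAt n γ j c) (suc K))   ∎
    where
    K = totient n / 2
    term : ℕ → Poly
    term j = scale (γ j) ((X ^ₚ j) *ₚ ((oneₚ +ₚ X) ^ₚ (totient n ∸ 2 ℕ.* j)))
    eval-X : eval c X ≡ c
    eval-X = cong proj₁ (evalᴰ-X c)
    eval-1+X : eval c (oneₚ +ₚ X) ≡ + 1 + c
    eval-1+X = cong proj₁ (trans (evalᴰ-+ₚ c oneₚ X) (cong₂ _+ᴰ_ (evalᴰ-const c (+ 1)) (evalᴰ-X c)))
    eval-term : ∀ j → eval c (term j) ≡ lucasTermAt n γ j c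
    eval-term j = begin
      eval c (term j)
        ≡⟨ cong proj₁ (evalᴰ-scale c (γ j) ((X ^ₚ j) *ₚ ((oneₚ +ₚ X) ^ₚ e))) ⟩
      γ j * eval c ((X ^ₚ j) *ₚ ((oneₚ +ₚ X) ^ₚ e))
        ≡⟨ cong (λ x → γ j * proj₁ x) (evalᴰ-*ₚ c (X ^ₚ j) ((oneₚ +ₚ X) ^ₚ e)) ⟩
      γ j * (eval c (X ^ₚ j) * eval c ((oneₚ +ₚ X) ^ₚ e))
        ≡⟨ cong₂ (λ a b → γ j * (a * b)) (trans (eval-^ₚ c X j) (cong (_^ j) eval-X))
                                         (trans (eval-^ₚ c (oneₚ +ₚ X) e) (cong (_^ e) eval-1+X)) ⟩
      lucasTermAt n γ j c
        ∎
      where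
      e = totient n ∸ 2 ℕ.* j

  eval-lucasExpansion-at-0 : ∀ n γ → eval (+ 0) (lucasExpansion n γ) ≡ γ 0
  eval-lucasExpansion-at-0 n γ =
    trans (eval-lucasExpansion (+ 0) n γ)
      (trans (∑-single (suc (totient n / 2)) (λ j → lucasTermAt n γ j (+ 0)) 0 (s≤s z≤n) higher≡0) lowest≡γ₀)
    where
    higher≡0 : ∀ j → j < suc (totient n / 2) → j ≢ 0 → lucasTermAt n γ j (+ 0) ≡ + 0
    higher≡0 zero    _ j≢0 = ⊥-elim (j≢0 refl)
    higher≡0 (suc j) _ _   = ℤₚ.*-zeroʳ (γ (suc j))
    lowest≡γ₀ : lucasTermAt n γ 0 (+ 0) ≡ γ 0
    lowest≡γ₀ = trans (cong (γ 0 *_) (trans (ℤₚ.*-identityˡ _) (ℤₚ.^-zeroˡ (totient n))))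
                      (ℤₚ.*-identityʳ (γ 0))

  φ∸2*[φ/2]≡φ%2 : ∀ φ → φ ∸ 2 ℕ.* (φ / 2) ≡ φ % 2
  φ∸2*[φ/2]≡φ%2 φ = begin
    φ ∸ 2 ℕ.* (φ / 2)                       ≡⟨ cong (_∸ 2 ℕ.* (φ / 2)) (m≡m%n+[m/n]*n φ 2) ⟩
    φ % 2 ℕ.+ φ / 2 ℕ.* 2 ∸ 2 ℕ.* (φ / 2)   ≡⟨ cong (λ x → φ % 2 ℕ.+ x ∸ 2 ℕ.* (φ / 2)) (ℕₚ.*-comm (φ / 2) 2) ⟩
    φ % 2 ℕ.+ 2 ℕ.* (φ / 2) ∸ 2 ℕ.* (φ / 2) ≡⟨ ℕₚ.m+n∸n≡m (φ % 2) (2 ℕ.* (φ / 2)) ⟩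
    φ % 2                                   ∎

  0<φ∸2*j : ∀ φ {j} → j < φ / 2 → 0 < φ ∸ 2 ℕ.* j
  0<φ∸2*j φ {j} j<φ/2 = ℕₚ.m<n⇒0<n∸m (ℕₚ.<-≤-trans (ℕₚ.*-monoʳ-< 2 j<φ/2)
                                         (subst (ℕ._≤ φ) (ℕₚ.*-comm (φ / 2) 2) (m/n*n≤m φ 2)))

  0^-positive : ∀ {e} → 0 < e → (+ 0) ^ e ≡ + 0
  0^-positive {suc e} _ = refl

  -1^≡signPow : ∀ k → (- + 1) ^ k ≡ signPow k
  -1^≡signPow zero    = refl
  -1^≡signPow (suc k) = trans (ℤₚ.-1*i≡-i ((- + 1) ^ k)) (cong -_ (-1^≡signPow k))

  lucasTermAt-−1-below-middle : ∀ n γ j → j < totient n / 2 → lucasTermAt n γ j (- + 1) ≡ + 0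
  lucasTermAt-−1-below-middle n γ j j<K = begin
    γ j * ((- + 1) ^ j * (+ 0) ^ (totient n ∸ 2 ℕ.* j))
      ≡⟨ cong (λ z → γ j * ((- + 1) ^ j * z)) (0^-positive (0<φ∸2*j (totient n) j<K)) ⟩
    γ j * ((- + 1) ^ j * + 0)
      ≡⟨ cong (γ j *_) (ℤₚ.*-zeroʳ ((- + 1) ^ j)) ⟩
    γ j * + 0
      ≡⟨ ℤₚ.*-zeroʳ (γ j) ⟩
    + 0
      ∎

  term-at-−1-cases : ∀ g K r → r < 2 → g * ((- + 1) ^ K * (+ 0) ^ r) ≡ + 0 ⊎ g * ((- + 1) ^ K * (+ 0) ^ r) ≡ signPow K * g
  term-at-−1-cases g K 0 _ = inj₂ (begin
    g * ((- + 1) ^ K * + 1)     ≡⟨ cong (g *_) (ℤₚ.*-identityʳ ((- + 1) ^ K)) ⟩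
    g * (- + 1) ^ K             ≡⟨ ℤₚ.*-comm g ((- + 1) ^ K) ⟩
    (- + 1) ^ K * g             ≡⟨ cong (_* g) (-1^≡signPow K) ⟩
    signPow K * g               ∎)
  term-at-−1-cases g K 1 _ = inj₁ (trans (cong (g *_) (ℤₚ.*-zeroʳ ((- + 1) ^ K))) (ℤₚ.*-zeroʳ g))
  term-at-−1-cases g K (suc (suc r)) (s≤s (s≤s ()))

  eval-lucasExpansion-at-−1≡middle : ∀ n γ →
    eval (- + 1) (lucasExpansion n γ) ≡ γ (totient n / 2) * ((- + 1) ^ (totient n / 2) * (+ 0) ^ (totient n % 2))
  eval-lucasExpansion-at-−1≡middle n γ = trans (eval-lucasExpansion (- + 1) n γ)
      (trans (∑-single (suc K) (λ j → lucasTermAt n γ j (- + 1)) K ℕₚ.≤-refl lower≡0)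
             (cong (λ e → γ K * ((- + 1) ^ K * (+ 0) ^ e)) (φ∸2*[φ/2]≡φ%2 (totient n))))
    where
    K = totient n / 2
    lower≡0 : ∀ j → j < suc K → j ≢ K → lucasTermAt n γ j (- + 1) ≡ + 0
    lower≡0 j (s≤s j≤K) j≢K = lucasTermAt-−1-below-middle n γ j (ℕₚ.≤∧≢⇒< j≤K j≢K)

  eval-lucasExpansion-at-−1 : ∀ n γ →
    eval (- + 1) (lucasExpansion n γ) ≡ + 0 ⊎ eval (- + 1) (lucasExpansion n γ) ≡ lucasCoeff γ (totient n / 2)
  eval-lucasExpansion-at-−1 n γ =
    Sum.map (trans (eval-lucasExpansion-at-−1≡middle n γ)) (trans (eval-lucasExpansion-at-−1≡middle n γ))
      (term-at-−1-cases (γ (totient n / 2)) (totient n / 2) (totient n % 2) (m%n<n (totient n) 2))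

  lucasCoeff-0 : ∀ n γ P → P ≈ₚ lucasExpansion n γ → lucasCoeff γ 0 ≡ eval (+ 0) P
  lucasCoeff-0 n γ P P≈ =
    trans (ℤₚ.*-identityˡ (γ 0)) (sym (trans (eval-cong (+ 0) {P} {lucasExpansion n γ} P≈) (eval-lucasExpansion-at-0 n γ)))

  lucasCoeff-middle : ∀ {v} n γ P → P ≈ₚ lucasExpansion n γ → eval (- + 1) P ≡ + v → .{{NonZero v}} →
    lucasCoeff γ (totient n / 2) ≡ + v
  lucasCoeff-middle {v} n γ P P≈ P≡v =
    nonzero-alternative (eval-lucasExpansion-at-−1 n γ) (trans (sym (eval-cong (- + 1) {P} {lucasExpansion n γ} P≈)) P≡v)
    where
    nonzero-alternative : ∀ {x y} → x ≡ + 0 ⊎ x ≡ y → x ≡ + v → y ≡ + v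
    nonzero-alternative (inj₁ x≡0) x≡v = contradiction (ℤₚ.+-injective (trans (sym x≡v) x≡0)) (ℕ.≢-nonZero⁻¹ v)
    nonzero-alternative (inj₂ x≡y) x≡v = trans (sym x≡y) x≡v

open import Data.Nat using (ℕ; _≤_; _*_; _^_; _/_)
open import Data.Nat.Properties using (<⇒≤)
open import Data.Nat.Primality using (Prime; prime⇒nonZero)
open import Data.Integer using (ℤ; +_)
open import Data.Product using (_×_; _,_; ∃-syntax)
open import Relation.Nullary using (¬_)
open import Relation.Binary.PropositionalEquality using (_≡_; trans)
open LucasExpansion using (lucasCoeff-0; lucasCoeff-middle)

lemma6p2 : (Φ : ℕ → Poly) → IsCyclotomicFamily Φ →
    (n : ℕ) → 3 ≤ n →
    (γ : ℕ → ℤ) → Φ n ≈ₚ lucasExpansion n γ →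
    (lucasCoeff γ 0 ≡ + 1)
    × ((p m : ℕ) → Prime p → 1 ≤ m → n ≡ 2 * p ^ m →
         lucasCoeff γ (totient n / 2) ≡ + p)
    × (¬ (∃[ p ] ∃[ m ] (Prime p × 1 ≤ m × n ≡ 2 * p ^ m)) →
         lucasCoeff γ (totient n / 2) ≡ + 1)
lemma6p2 Φ isΦ n 3≤n γ Φₙ≈ =
    trans (lucasCoeff-0 n γ (Φ n) Φₙ≈) (Φ-at-0 n (<⇒≤ 3≤n))
  , (λ p m pp 1≤m n≡ → lucasCoeff-middle n γ (Φ n) Φₙ≈ (Φ-at-−1-twice-prime-power pp 1≤m n≡) {{prime⇒nonZero pp}})
  , (λ not-twice-prime-power → lucasCoeff-middle n γ (Φ n) Φₙ≈ (Φ-at-−1-otherwise n 3≤n not-twice-prime-power))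
  where
  open CyclotomicValues Φ isΦ
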